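{- If $k$ is a positive integer and $n_1,\dots,n_k$ are integers with $n_i \geq 3$ for $1\leq i\leq k$, then $B(\boxtimes_{i=1}^k P_{n_i}) = 3^k - 1$.
   Context: $P_n$ is the path on $n$ vertices and $\boxtimes_{i=1}^k P_{n_i} = P_{n_1}\boxtimes\cdots\boxtimes P_{n_k}$, where the strong product $G\boxtimes H$ has vertex set $V(G)\times V(H)$, with distinct $(u,v)$ and $(x,y)$ adjacent iff either $ux \in E(G)$ and $v=y$, or $u=x$ and $vy\in E(H)$, or $ux \in E(G)$ and $vy\in E(H)$. Bodyguards and Presidents is a two-player game on a finite simple graph $G$. One player controls a set of tokens called bodyguards, the other a single token called the president. First all bodyguards are placed on vertices (several may share a vertex), then the president is placed. The players then alternate turns, bodyguards first; on a player's turn, each token they control either moves to an adjacent vertex or stays put. The president is surrounded if every vertex of the open neighbourhood of the president's vertex is occupied by a bodyguard. The bodyguards win if there is a finite time after which, at the end of every bodyguard turn, the president is surrounded; otherwise the president wins. The bodyguard number $B(G)$ is the minimum number of bodyguards that guarantees a win for the bodyguards on $G$. -}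

module Defs where

open import Data.Nat using (ℕ; zero; suc; _≤_; _<_)
open import Data.Fin using (Fin; toℕ)
open import Data.Vec using (Vec; []; _∷_)
open import Data.List using (List; []; _∷_)
open import Data.Product using (_×_; _,_; ∃; Σ)
open import Data.Sum using (_⊎_)
open import Relation.Binary.PropositionalEquality using (_≡_)
open import Relation.Nullary using (¬_)

record Graph : Set₁ where
  field
    Vertex : Set
    _~_    : Vertex → Vertex → Set
open Graph public

P : ℕ → Graph
Vertex (P n) = Fin n
_~_ (P n) i j = toℕ i ≡ suc (toℕ j) ⊎ toℕ j ≡ suc (toℕ i)

_⊠_ : Graph → Graph → Graph
Vertex (G ⊠ H) = Vertex G × Vertex H
_~_ (G ⊠ H) (u , v) (x , y) =
  ¬ ((u , v) ≡ (x , y)) ×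
  ( ((_~_ G u x) × (v ≡ y))
  ⊎ ((u ≡ x) × (_~_ H v y))
  ⊎ ((_~_ G u x) × (_~_ H v y)) )

⊠P : ∀ {k} → Vec ℕ (suc k) → Graph
⊠P (n ∷ [])     = P n
⊠P (n ∷ m ∷ ns) = P n ⊠ ⊠P (m ∷ ns)

module Game (G : Graph) where
  V = Vertex G

  Step : V → V → Set
  Step x y = x ≡ y ⊎ _~_ G x y

  -- positions of m bodyguards (several may share a vertex)
  Config : ℕ → Set
  Config m = Fin m → V

  Surrounded : ∀ {m} → Config m → V → Set
  Surrounded {m} C v = ∀ w → _~_ G v w → ∃ λ (j : Fin m) → C j ≡ w

  -- A bodyguard strategy: given the president's history (most recent first)
  -- p_{t-1} ∷ … ∷ p_0 ∷ [], it gives the bodyguard configuration B_t after the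
  -- bodyguards' t-th turn (t = 0: initial placement).
  record Strategy (m : ℕ) : Set where
    field
      place : List V → Config m
      legal : ∀ h p (j : Fin m) → Step (place h j) (place (p ∷ h) j)
  open Strategy public

  -- a president play: initial placement p 0, p t is his position after his t-th move
  PresidentPlay : (ℕ → V) → Set
  PresidentPlay p = ∀ t → Step (p t) (p (suc t))

  history : (ℕ → V) → ℕ → List V
  history p zero    = []
  history p (suc t) = p t ∷ history p t

  -- the strategy wins: against every president play, from some time on the
  -- president is surrounded at the end of every bodyguard turn
  -- (after bodyguard turn t+1 the president is at p t).
  Winning : ∀ {m} → Strategy m → Set
  Winning σ = ∀ p → PresidentPlay p →
    ∃ λ T → ∀ t → T ≤ t → Surrounded (place σ (history p (suc t))) (p t)

  BodyguardsWin : ℕ → Set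
  BodyguardsWin m = Σ (Strategy m) Winning

BodyguardNumberIs : Graph → ℕ → Set
BodyguardNumberIs G b = Game.BodyguardsWin G b × (∀ m → m < b → ¬ Game.BodyguardsWin G m)

{-# OPTIONS --safe #-}

-- Number the 3^k moves of a king in ⊠ P_{n_i} so that move 0 is "stay", and let
-- bodyguard j chase the image of the president under move j + 1, every coordinate
-- being truncated at the ends of its path.  These images are 1-Lipschitz in the
-- president's position, so each is a walk, and a greedy pursuer on a path of length n
-- catches any walk within n rounds: until it does, it moves in the same direction at
-- every round.  Running this in every coordinate, after Σ n_i rounds all bodyguards sit
-- on their targets, which fill the president's neighbourhood.  Conversely, a president
-- who never leaves the centre (1, …, 1) has 3^k - 1 distinct neighbours, all of which
-- must eventually be occupied.

module Submission where

open import Defs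
open import Data.Nat as ℕ using (ℕ; zero; suc; _+_; _*_; _^_; _∸_; _⊓_; _≤_; _<_; z≤n; s≤s)
open import Data.Nat.Properties
import Data.Fin.Properties as Fin
open import Data.Fin using (Fin; zero; suc; toℕ; fromℕ<; inject₁; pred; combine; remQuot)
open import Data.Fin.Properties
  using (toℕ-injective; toℕ<n; toℕ≤pred[n]; toℕ-fromℕ<; toℕ-inject₁; remQuot-combine; combine-remQuot; injective⇒≤)
open import Data.Vec using (Vec; []; _∷_)
open import Data.Vec.Relation.Unary.All using (All; []; _∷_)
open import Data.List using (List; []; _∷_)
open import Data.Product using (_×_; _,_; ∃; proj₁; proj₂; uncurry)
open import Data.Sum using (inj₁; inj₂)
open import Function using (_∘_)
open import Function.Definitions using (Injective)
open import Relation.Binary.Definitions using (Irreflexive; tri<; tri≈; tri>)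
open import Relation.Binary.PropositionalEquality
open import Relation.Nullary using (¬_; contradiction)

open Game using (Step)

private
  variable
    a b c k m n t x y M N : ℕ
    G H : Graph

record Pursuit (G : Graph) : Set where
  field
    chase      : Vertex G → Vertex G → Vertex G
    chase-step : ∀ b c → Step G b (chase b c)
    time       : ℕ
    catches    : ∀ (bs cs : ℕ → Vertex G) → (∀ t → Step G (cs t) (cs (suc t))) →
                 (∀ t → bs (suc t) ≡ chase (bs t) (cs t)) → ∀ t → time ≤ t → bs (suc t) ≡ cs t

record Moves (G : Graph) (M : ℕ) : Set where
  field
    move      : Fin (suc M) → Vertex G → Vertex G
    move-zero : ∀ p → move zero p ≡ p
    move-step : ∀ d {p q} → Step G p q → Step G (move d p) (move d q)
    move-near : ∀ d p → Step G p (move d p)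
    move-onto : ∀ {p w} → Step G p w → ∃ λ d → move d p ≡ w

module _ {G : Graph} where
  open Game G

  following : Pursuit G → Moves G M → V → List V → Config M
  following 𝒫 ℳ v₀ []      j = v₀
  following 𝒫 ℳ v₀ (p ∷ h) j = Pursuit.chase 𝒫 (following 𝒫 ℳ v₀ h j) (Moves.move ℳ (suc j) p)

  follow : Pursuit G → Moves G M → V → Strategy M
  follow 𝒫 ℳ v₀ = record
    { place = following 𝒫 ℳ v₀
    ; legal = λ h p j → Pursuit.chase-step 𝒫 (following 𝒫 ℳ v₀ h j) _
    }

  follow-wins : Irreflexive _≡_ (_~_ G) → (𝒫 : Pursuit G) (ℳ : Moves G M) (v₀ : V) → Winning (follow 𝒫 ℳ v₀)
  follow-wins irr 𝒫 ℳ v₀ p play = time , surrounded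
    where
    open Pursuit 𝒫
    open Moves ℳ
    surrounded : ∀ t → time ≤ t → Surrounded (following 𝒫 ℳ v₀ (history p (suc t))) (p t)
    surrounded t T≤t w pw with move-onto (inj₂ pw)
    ... | zero  , e = contradiction pw (irr (trans (sym (move-zero (p t))) e))
    ... | suc j , e = j , trans
      (catches (λ t → following 𝒫 ℳ v₀ (history p t) j) (λ t → move (suc j) (p t))
               (λ t → move-step (suc j) (play t)) (λ _ → refl) t T≤t)
      e

  distinct-neighbours⇒¬win : (v : V) (f : Fin M → V) → Injective _≡_ _≡_ f → (∀ j → _~_ G v (f j)) →
    m < M → ¬ BodyguardsWin m
  distinct-neighbours⇒¬win v f f-injective v~f m<M (σ , wins) with wins (λ _ → v) (λ _ → inj₁ refl)
  ... | T , surrounded = <⇒≱ m<M (injective⇒≤ guard-injective)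
    where
    occupied : ∀ j → ∃ λ i → place σ (history (λ _ → v) (suc T)) i ≡ f j
    occupied j = surrounded T ≤-refl (f j) (v~f j)
    guard-injective : Injective _≡_ _≡_ (proj₁ ∘ occupied)
    guard-injective {i} {j} e = f-injective (begin
      f i                                                        ≡⟨ proj₂ (occupied i) ⟨
      place σ (history (λ _ → v) (suc T)) (proj₁ (occupied i))   ≡⟨ cong (place σ _) e ⟩
      place σ (history (λ _ → v) (suc T)) (proj₁ (occupied j))   ≡⟨ proj₂ (occupied j) ⟩
      f j                                                        ∎)
      where open ≡-Reasoning

  moves⇒bodyguardNumberIs : Irreflexive _≡_ (_~_ G) → Pursuit G → (ℳ : Moves G M) (v : V) →
    Injective _≡_ _≡_ (λ d → Moves.move ℳ d v) → BodyguardNumberIs G M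
  moves⇒bodyguardNumberIs irr 𝒫 ℳ v separates =
    (follow 𝒫 ℳ v , follow-wins irr 𝒫 ℳ v) ,
    λ m m<M → distinct-neighbours⇒¬win v (λ j → move (suc j) v) (Fin.suc-injective ∘ separates) adjacent m<M
    where
    open Moves ℳ
    adjacent : ∀ j → _~_ G v (move (suc j) v)
    adjacent j with move-near (suc j) v
    ... | inj₂ v~w = v~w
    ... | inj₁ v≡w with separates (trans (move-zero v) v≡w)
    ...   | ()

remQuot-injective : ∀ n → Injective _≡_ _≡_ (remQuot {m} n)
remQuot-injective {m} n {i} {j} e = begin
  i                                ≡⟨ combine-remQuot {m} n i ⟨
  uncurry combine (remQuot {m} n i) ≡⟨ cong (uncurry combine) e ⟩
  uncurry combine (remQuot {m} n j) ≡⟨ combine-remQuot {m} n j ⟩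
  j                                ∎
  where open ≡-Reasoning

⊠-irreflexive : Irreflexive _≡_ (_~_ (G ⊠ H))
⊠-irreflexive refl (u≢u , _) = u≢u refl

⊠-step⁻ : ∀ {u x : Vertex G} {v y : Vertex H} →
  Step (G ⊠ H) (u , v) (x , y) → Step G u x × Step H v y
⊠-step⁻ (inj₁ refl)                          = inj₁ refl , inj₁ refl
⊠-step⁻ (inj₂ (_ , inj₁ (ux , refl)))        = inj₂ ux , inj₁ refl
⊠-step⁻ (inj₂ (_ , inj₂ (inj₁ (refl , vy)))) = inj₁ refl , inj₂ vy
⊠-step⁻ (inj₂ (_ , inj₂ (inj₂ (ux , vy))))   = inj₂ ux , inj₂ vy

module _ (irrG : Irreflexive _≡_ (_~_ G)) (irrH : Irreflexive _≡_ (_~_ H)) where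

  ⊠-step⁺ : ∀ {u x : Vertex G} {v y : Vertex H} →
    Step G u x → Step H v y → Step (G ⊠ H) (u , v) (x , y)
  ⊠-step⁺ (inj₁ refl) (inj₁ refl) = inj₁ refl
  ⊠-step⁺ (inj₁ refl) (inj₂ vy)   = inj₂ ((λ e → irrH (cong proj₂ e) vy) , inj₂ (inj₁ (refl , vy)))
  ⊠-step⁺ (inj₂ ux)   (inj₁ refl) = inj₂ ((λ e → irrG (cong proj₁ e) ux) , inj₁ (ux , refl))
  ⊠-step⁺ (inj₂ ux)   (inj₂ vy)   = inj₂ ((λ e → irrG (cong proj₁ e) ux) , inj₂ (inj₂ (ux , vy)))

  ⊠-pursuit : Pursuit G → Pursuit H → Pursuit (G ⊠ H)
  ⊠-pursuit 𝒫 𝒬 = record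
    { chase      = λ (b , b′) (c , c′) → 𝒫.chase b c , 𝒬.chase b′ c′
    ; chase-step = λ _ _ → ⊠-step⁺ (𝒫.chase-step _ _) (𝒬.chase-step _ _)
    ; time       = 𝒫.time + 𝒬.time
    ; catches    = λ bs cs walk follows t T≤t → cong₂ _,_
        (𝒫.catches (proj₁ ∘ bs) (proj₁ ∘ cs) (proj₁ ∘ ⊠-step⁻ {G = G} {H = H} ∘ walk) (cong proj₁ ∘ follows)
                   t (≤-trans (m≤m+n _ _) T≤t))
        (𝒬.catches (proj₂ ∘ bs) (proj₂ ∘ cs) (proj₂ ∘ ⊠-step⁻ {G = G} {H = H} ∘ walk) (cong proj₂ ∘ follows)
                   t (≤-trans (m≤n+m _ _) T≤t))
    }
    where
    module 𝒫 = Pursuit 𝒫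
    module 𝒬 = Pursuit 𝒬

  ⊠-moves : Moves G M → Moves H N → Moves (G ⊠ H) (N + M * suc N)
  ⊠-moves {M = M} {N = N} ℳ 𝒩 = record
    { move      = move
    ; move-zero = λ (p , q) → cong₂ _,_ (ℳ.move-zero p) (𝒩.move-zero q)
    ; move-step = λ c s → let (s₁ , s₂) = ⊠-step⁻ {G = G} {H = H} s in
        ⊠-step⁺ (ℳ.move-step (proj₁ (split c)) s₁) (𝒩.move-step (proj₂ (split c)) s₂)
    ; move-near = λ c (p , q) → ⊠-step⁺ (ℳ.move-near (proj₁ (split c)) p) (𝒩.move-near (proj₂ (split c)) q)
    ; move-onto = move-onto
    }
    where
    module ℳ = Moves ℳ
    module 𝒩 = Moves 𝒩

    split : Fin (suc M * suc N) → Fin (suc M) × Fin (suc N)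
    split = remQuot {suc M} (suc N)

    move : Fin (suc M * suc N) → Vertex (G ⊠ H) → Vertex (G ⊠ H)
    move c (p , q) = ℳ.move (proj₁ (split c)) p , 𝒩.move (proj₂ (split c)) q

    move-onto : ∀ {p w} → Step (G ⊠ H) p w → ∃ λ c → move c p ≡ w
    move-onto {p , q} s with ⊠-step⁻ {G = G} {H = H} s
    ... | s₁ , s₂ with ℳ.move-onto s₁ | 𝒩.move-onto s₂
    ...   | d , refl | e , refl = combine d e ,
      cong (λ (d , e) → ℳ.move d p , 𝒩.move e q) (remQuot-combine d e)

  ⊠-separates : (ℳ : Moves G M) (𝒩 : Moves H N) {v : Vertex G} {w : Vertex H} →
    Injective _≡_ _≡_ (λ d → Moves.move ℳ d v) → Injective _≡_ _≡_ (λ e → Moves.move 𝒩 e w) →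
    Injective _≡_ _≡_ (λ c → Moves.move (⊠-moves ℳ 𝒩) c (v , w))
  ⊠-separates {N = N} ℳ 𝒩 sep₁ sep₂ e =
    remQuot-injective (suc N) (cong₂ _,_ (sep₁ (cong proj₁ e)) (sep₂ (cong proj₂ e)))

Close : ℕ → ℕ → Set
Close a b = a ≤ suc b × b ≤ suc a

close-suc : Close a b → Close (suc a) (suc b)
close-suc (a≤ , b≤) = s≤s a≤ , s≤s b≤

close-pred : Close a b → Close (ℕ.pred a) (ℕ.pred b)
close-pred {zero}  {zero}  ab                = ab
close-pred {zero}  {suc b} (_ , s≤s b≤0)     = z≤n , m≤n⇒m≤1+n b≤0
close-pred {suc a} {zero}  (s≤s a≤0 , _)     = m≤n⇒m≤1+n a≤0 , z≤n
close-pred {suc a} {suc b} (s≤s a≤ , s≤s b≤) = a≤ , b≤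

close-⊓ : ∀ m → Close a b → Close (a ⊓ m) (b ⊓ m)
close-⊓ m (a≤ , b≤) = ⊓-mono-≤ a≤ (n≤1+n m) , ⊓-mono-≤ b≤ (n≤1+n m)

close-pred-self : ∀ a → Close a (ℕ.pred a)
close-pred-self zero    = z≤n , z≤n
close-pred-self (suc a) = ≤-refl , m≤n⇒m≤1+n (n≤1+n a)

close-suc⊓ : a ≤ m → Close a (suc a ⊓ m)
close-suc⊓ {a} {m} a≤m = m≤n⇒m≤1+n (⊓-glb (n≤1+n a) a≤m) , m⊓n≤m (suc a) m

data Toward : ℕ → ℕ → ℕ → Set where
  reach   : Close b c → Toward b c c
  ascend  : suc b < c → Toward b c (suc b)
  descend : c < x → Toward (suc x) c x

toward-suc : Toward b c x → Toward (suc b) (suc c) (suc x)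
toward-suc (reach bc)  = reach (close-suc bc)
toward-suc (ascend l)  = ascend (s≤s l)
toward-suc (descend l) = descend (s≤s l)

toward⇒close : Toward b c x → Close b x
toward⇒close (reach bc)          = bc
toward⇒close (ascend {b} _)      = m≤n⇒m≤1+n (n≤1+n b) , ≤-refl
toward⇒close (descend {x = x} _) = ≤-refl , m≤n⇒m≤1+n (n≤1+n x)

-- Pursuer x and target y after t + 1 greedy steps on the path 0 … n - 1: unless the
-- target is caught, the pursuer has moved in the same direction at every step.
data Pursuing (n t : ℕ) : ℕ → ℕ → Set where
  caught : Pursuing n t y y
  below  : x < y → t < x → Pursuing n t x y
  above  : y < x → suc t + x < n → Pursuing n t x y

pursuing-start : b < n → Toward b c x → Pursuing n 0 x c
pursuing-start _   (reach _)   = caught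
pursuing-start _   (ascend l)  = below l (s≤s z≤n)
pursuing-start b<n (descend l) = above l b<n

below-progress : x < y → Pursuing n t x y → t < x
below-progress x<y caught        = contradiction x<y (<-irrefl refl)
below-progress x<y (below _ t<x) = t<x
below-progress x<y (above y<x _) = contradiction y<x (<-asym x<y)

above-progress : y < x → Pursuing n t x y → suc t + x < n
above-progress y<x caught        = contradiction y<x (<-irrefl refl)
above-progress y<x (below x<y _) = contradiction y<x (<-asym x<y)
above-progress y<x (above _ h)   = h

pursuing-step : ∀ {y′ x′} → Close y y′ → Toward x y′ x′ → Pursuing n t x y → Pursuing n (suc t) x′ y′
pursuing-step _ (reach _) _ = caught
pursuing-step (_ , y′≤) (ascend l) p =
  below l (s≤s (below-progress (≤-pred (≤-trans l y′≤)) p))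
pursuing-step {n = n} {t = t} (y≤ , _) (descend {x = x′} l) p =
  above l (subst (_< n) (+-suc (suc t) x′) (above-progress (s≤s (≤-trans y≤ l)) p))

pursuing-end : n ≤ t → x < n → Pursuing n t x y → x ≡ y
pursuing-end _   _   caught        = refl
pursuing-end n≤t x<n (below _ t<x) = contradiction (<-trans t<x x<n) (≤⇒≯ n≤t)
pursuing-end n≤t _   (above _ h)   = contradiction (<⇒≤ (≤-<-trans (m≤m+n (suc _) _) h)) (≤⇒≯ n≤t)

greedy-pursuing : (bs cs : ℕ → ℕ) → (∀ t → bs t < n) → (∀ t → Close (cs t) (cs (suc t))) →
  (∀ t → Toward (bs t) (cs t) (bs (suc t))) → ∀ t → Pursuing n t (bs (suc t)) (cs t)
greedy-pursuing bs cs bs<n walk toward zero    = pursuing-start (bs<n 0) (toward 0)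
greedy-pursuing bs cs bs<n walk toward (suc t) =
  pursuing-step (walk t) (toward (suc t)) (greedy-pursuing bs cs bs<n walk toward t)

step⇒close : ∀ {i j : Fin n} → Step (P n) i j → Close (toℕ i) (toℕ j)
step⇒close {i = i} (inj₁ refl) = n≤1+n (toℕ i) , n≤1+n (toℕ i)
step⇒close (inj₂ (inj₁ i≡1+j)) rewrite i≡1+j = ≤-refl , m≤n⇒m≤1+n (n≤1+n _)
step⇒close (inj₂ (inj₂ j≡1+i)) rewrite j≡1+i = m≤n⇒m≤1+n (n≤1+n _) , ≤-refl

close⇒step : ∀ {i j : Fin n} → Close (toℕ i) (toℕ j) → Step (P n) i j
close⇒step {i = i} {j} (i≤ , j≤) with <-cmp (toℕ i) (toℕ j)
... | tri< i<j _ _ = inj₂ (inj₂ (≤-antisym j≤ i<j))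
... | tri≈ _ i≡j _ = inj₁ (toℕ-injective i≡j)
... | tri> _ _ j<i = inj₂ (inj₁ (≤-antisym i≤ j<i))

P-irreflexive : Irreflexive _≡_ (_~_ (P n))
P-irreflexive {x = i} refl (inj₁ i≡1+i) = <-irrefl i≡1+i (n<1+n (toℕ i))
P-irreflexive {x = i} refl (inj₂ i≡1+i) = <-irrefl i≡1+i (n<1+n (toℕ i))

stepToward : Fin n → Fin n → Fin n
stepToward zero    zero          = zero
stepToward zero    (suc zero)    = suc zero
stepToward zero    (suc (suc _)) = suc zero
stepToward (suc b) zero          = inject₁ b
stepToward (suc b) (suc c)       = suc (stepToward b c)

stepToward-toward : ∀ (b c : Fin n) → Toward (toℕ b) (toℕ c) (toℕ (stepToward b c))
stepToward-toward zero          zero          = reach (z≤n , z≤n)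
stepToward-toward zero          (suc zero)    = reach (z≤n , s≤s z≤n)
stepToward-toward zero          (suc (suc _)) = ascend (s≤s (s≤s z≤n))
stepToward-toward (suc zero)    zero          = reach (s≤s z≤n , z≤n)
stepToward-toward (suc (suc b)) zero rewrite toℕ-inject₁ b = descend (s≤s z≤n)
stepToward-toward (suc b)       (suc c)       = toward-suc (stepToward-toward b c)

pathPursuit : ∀ n → Pursuit (P n)
pathPursuit n = record
  { chase      = stepToward
  ; chase-step = λ b c → close⇒step (toward⇒close (stepToward-toward b c))
  ; time       = n
  ; catches    = catches
  }
  where
  catches : ∀ (bs cs : ℕ → Fin n) → (∀ t → Step (P n) (cs t) (cs (suc t))) →
            (∀ t → bs (suc t) ≡ stepToward (bs t) (cs t)) → ∀ t → n ≤ t → bs (suc t) ≡ cs t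
  catches bs cs walk follows t n≤t =
    toℕ-injective (pursuing-end n≤t (toℕ<n (bs (suc t)))
      (greedy-pursuing (toℕ ∘ bs) (toℕ ∘ cs) (toℕ<n ∘ bs) (step⇒close ∘ walk) toward t))
    where
    toward : ∀ t → Toward (toℕ (bs t)) (toℕ (cs t)) (toℕ (bs (suc t)))
    toward t = subst (Toward _ _ ∘ toℕ) (sym (follows t)) (stepToward-toward (bs t) (cs t))

up : Fin n → Fin n
up i = fromℕ< (bound (toℕ<n i))
  where
  bound : a < n → suc a ⊓ ℕ.pred n < n
  bound {n = suc m} _ = s≤s (m⊓n≤n _ m)

toℕ-up : ∀ (i : Fin n) → toℕ (up i) ≡ suc (toℕ i) ⊓ ℕ.pred n
toℕ-up i = toℕ-fromℕ< _

toℕ-pred : ∀ (i : Fin n) → toℕ (pred i) ≡ ℕ.pred (toℕ i)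
toℕ-pred zero    = refl
toℕ-pred (suc i) = toℕ-inject₁ i

pathMove : Fin 3 → Fin n → Fin n
pathMove zero             i = i
pathMove (suc zero)       i = up i
pathMove (suc (suc zero)) i = pred i

pathMoves : ∀ n → Moves (P n) 2
pathMoves n = record
  { move      = pathMove
  ; move-zero = λ _ → refl
  ; move-step = move-step
  ; move-near = move-near
  ; move-onto = move-onto
  }
  where
  move-step : ∀ d {p q : Fin n} → Step (P n) p q → Step (P n) (pathMove d p) (pathMove d q)
  move-step zero                     s = s
  move-step (suc zero)       {p} {q} s = close⇒step
    (subst₂ Close (sym (toℕ-up p)) (sym (toℕ-up q)) (close-⊓ _ (close-suc (step⇒close s))))
  move-step (suc (suc zero)) {p} {q} s = close⇒step
    (subst₂ Close (sym (toℕ-pred p)) (sym (toℕ-pred q)) (close-pred (step⇒close s)))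

  move-near : ∀ d (p : Fin n) → Step (P n) p (pathMove d p)
  move-near zero             p = inj₁ refl
  move-near (suc zero)       p = close⇒step (subst (Close _) (sym (toℕ-up p)) (close-suc⊓ (toℕ≤pred[n] p)))
  move-near (suc (suc zero)) p = close⇒step (subst (Close _) (sym (toℕ-pred p)) (close-pred-self _))

  move-onto : ∀ {p w : Fin n} → Step (P n) p w → ∃ λ d → pathMove d p ≡ w
  move-onto (inj₁ refl)                 = zero , refl
  move-onto {p} (inj₂ (inj₁ p≡1+w))     = suc (suc zero) , toℕ-injective (trans (toℕ-pred p) (cong ℕ.pred p≡1+w))
  move-onto {p} {w} (inj₂ (inj₂ w≡1+p)) = suc zero , toℕ-injective (begin
    toℕ (up p)                  ≡⟨ toℕ-up p ⟩
    suc (toℕ p) ⊓ ℕ.pred n      ≡⟨ m≤n⇒m⊓n≡m (subst (_≤ ℕ.pred n) w≡1+p (toℕ≤pred[n] w)) ⟩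
    suc (toℕ p)                 ≡⟨ sym w≡1+p ⟩
    toℕ w                       ∎)
    where open ≡-Reasoning

middle : 3 ≤ n → Fin n
middle (s≤s (s≤s (s≤s _))) = suc zero

middle-separates : (h : 3 ≤ n) → Injective _≡_ _≡_ (λ d → pathMove d (middle h))
middle-separates (s≤s (s≤s (s≤s _))) {zero}           {zero}           _  = refl
middle-separates (s≤s (s≤s (s≤s _))) {suc zero}       {suc zero}       _  = refl
middle-separates (s≤s (s≤s (s≤s _))) {suc (suc zero)} {suc (suc zero)} _  = refl
middle-separates (s≤s (s≤s (s≤s _))) {zero}           {suc zero}       ()
middle-separates (s≤s (s≤s (s≤s _))) {zero}           {suc (suc zero)} ()
middle-separates (s≤s (s≤s (s≤s _))) {suc zero}       {zero}           ()
middle-separates (s≤s (s≤s (s≤s _))) {suc zero}       {suc (suc zero)} ()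
middle-separates (s≤s (s≤s (s≤s _))) {suc (suc zero)} {zero}           ()
middle-separates (s≤s (s≤s (s≤s _))) {suc (suc zero)} {suc zero}       ()

kingDegree : ℕ → ℕ
kingDegree zero    = 2
kingDegree (suc k) = kingDegree k + 2 * suc (kingDegree k)

suc-kingDegree : ∀ k → suc (kingDegree k) ≡ 3 ^ suc k
suc-kingDegree zero    = refl
suc-kingDegree (suc k) = cong (3 *_) (suc-kingDegree k)

⊠P-irreflexive : (ns : Vec ℕ (suc k)) → Irreflexive _≡_ (_~_ (⊠P ns))
⊠P-irreflexive (n ∷ [])     = P-irreflexive
⊠P-irreflexive (n ∷ m ∷ ns) = ⊠-irreflexive {G = P n} {H = ⊠P (m ∷ ns)}

⊠P-pursuit : (ns : Vec ℕ (suc k)) → Pursuit (⊠P ns)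
⊠P-pursuit (n ∷ [])     = pathPursuit n
⊠P-pursuit (n ∷ m ∷ ns) =
  ⊠-pursuit P-irreflexive (⊠P-irreflexive (m ∷ ns)) (pathPursuit n) (⊠P-pursuit (m ∷ ns))

⊠P-moves : (ns : Vec ℕ (suc k)) → Moves (⊠P ns) (kingDegree k)
⊠P-moves (n ∷ [])     = pathMoves n
⊠P-moves (n ∷ m ∷ ns) = ⊠-moves P-irreflexive (⊠P-irreflexive (m ∷ ns)) (pathMoves n) (⊠P-moves (m ∷ ns))

centre : {ns : Vec ℕ (suc k)} → All (3 ≤_) ns → Vertex (⊠P ns)
centre (h ∷ [])      = middle h
centre (h ∷ h′ ∷ hs) = middle h , centre (h′ ∷ hs)

centre-separates : {ns : Vec ℕ (suc k)} (hs : All (3 ≤_) ns) →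
  Injective _≡_ _≡_ (λ d → Moves.move (⊠P-moves ns) d (centre hs))
centre-separates (h ∷ [])      = middle-separates h
centre-separates {ns = n ∷ m ∷ ns} (h ∷ h′ ∷ hs) =
  ⊠-separates P-irreflexive (⊠P-irreflexive (m ∷ ns)) (pathMoves n) (⊠P-moves (m ∷ ns))
    (middle-separates h) (centre-separates (h′ ∷ hs))

theorem5p3 : ∀ (k' : ℕ) (ns : Vec ℕ (suc k')) → All (3 ≤_) ns →
    BodyguardNumberIs (⊠P ns) (3 ^ suc k' ∸ 1)
theorem5p3 k' ns hs =
  subst (BodyguardNumberIs (⊠P ns)) (cong (_∸ 1) (suc-kingDegree k'))
    (moves⇒bodyguardNumberIs (⊠P-irreflexive ns) (⊠P-pursuit ns) (⊠P-moves ns) (centre hs) (centre-separates hs))
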